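{- Let $T$ be a tournament and $k\ge 0$ an integer, let $A'\subseteq A(T)$ be a DESC-set of $T$ with $|A'|\le k$, and let $T'=T-A'$. Suppose $X\subseteq V(T)$ satisfies $|X|\ge 4k+3$ and $\max_{x\in X}d^+_T(x)-\min_{x\in X}d^+_T(x)\le k$. Then all vertices of $X$ belong to one strong component of $T'$.
   Context: $d^+_T(x)$ is the out-degree of $x$ in $T$. A digraph is Eulerian iff it is strongly connected and balanced (every vertex has equal in- and out-degree); a single vertex counts as strongly connected. $T-A'$ denotes $T$ with the arcs of $A'$ deleted. A set $A'\subseteq A(T)$ is a DESC-set if every strong component of $T-A'$ is Eulerian. -}

module Defs where

open import Data.Nat using (ℕ; _+_; _≤_)
open import Data.Bool using (Bool; true; false; _∧_; not; _xor_)
open import Data.Fin using (Fin)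
open import Data.Fin.Subset using (Subset; _∈_; ∣_∣; _∩_)
open import Data.Vec using (tabulate)
open import Data.List using (map; allFin)
open import Data.Nat.ListAction using (sum)
open import Data.Product using (_×_)
open import Relation.Binary.PropositionalEquality using (_≡_; _≢_)
open import Relation.Binary.Construct.Closure.ReflexiveTransitive using (Star)

Digraph : ℕ → Set
Digraph n = Fin n → Fin n → Bool

IsTournament : ∀ {n} → Digraph n → Set
IsTournament {n} T =
  ((x : Fin n) → T x x ≡ false) ×
  ((x y : Fin n) → x ≢ y → (T x y xor T y x) ≡ true)

_⊆Arcs_ : ∀ {n} → Digraph n → Digraph n → Set
_⊆Arcs_ {n} A′ T = (x y : Fin n) → A′ x y ≡ true → T x y ≡ true

numArcs : ∀ {n} → Digraph n → ℕ
numArcs {n} D = sum (map (λ x → ∣ tabulate (D x) ∣) (allFin n))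

_−_ : ∀ {n} → Digraph n → Digraph n → Digraph n
(T − A′) x y = T x y ∧ not (A′ x y)

outNbrs : ∀ {n} → Digraph n → Fin n → Subset n
outNbrs D x = tabulate (λ y → D x y)

inNbrs : ∀ {n} → Digraph n → Fin n → Subset n
inNbrs D x = tabulate (λ y → D y x)

outdeg : ∀ {n} → Digraph n → Fin n → ℕ
outdeg D x = ∣ outNbrs D x ∣

Reach : ∀ {n} → Digraph n → Fin n → Fin n → Set
Reach D = Star (λ x y → D x y ≡ true)

IsStrongComponentOf : ∀ {n} → Digraph n → Subset n → Fin n → Set
IsStrongComponentOf {n} D C v =
  v ∈ C ×
  ((u : Fin n) → (u ∈ C → Reach D v u × Reach D u v) × (Reach D v u × Reach D u v → u ∈ C))

IsEulerianOn : ∀ {n} → Digraph n → Subset n → Set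
IsEulerianOn {n} D C =
  ((u w : Fin n) → u ∈ C → w ∈ C → Star (λ x y → x ∈ C × y ∈ C × D x y ≡ true) u w) ×
  ((u : Fin n) → u ∈ C → ∣ C ∩ outNbrs D u ∣ ≡ ∣ C ∩ inNbrs D u ∣)

IsDESC : ∀ {n} → Digraph n → Digraph n → Set
IsDESC {n} T A′ = (v : Fin n) (C : Subset n) → IsStrongComponentOf (T − A′) C v → IsEulerianOn (T − A′) C

-- A vertex is clean if no arc of A′ touches it; at most 2k vertices are not, so at least 2k + 3 vertices
-- of X are clean. In T − A′ a clean vertex v is adjacent to every other vertex, hence comparable with every
-- vertex under reachability, and as its strong component C v is Eulerian, 2 d⁺(v) + 1 = |C v| + 2 |B v|,
-- where B v is the set of vertices reachable from v that do not reach v. For clean u above w this gives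
-- 2 d⁺(u) = 2 d⁺(w) + |C u| + |C w| + 2 |M|, with M the part of B u not reachable from w, so out-degree
-- strictly decreases downwards. Hence the clean vertex u of largest out-degree reaches every clean vertex,
-- and the clean vertex w of smallest out-degree is reached by every clean vertex. If w did not reach u,
-- all clean vertices would lie in C u ∪ C w ∪ M, of size at most 2 (d⁺(u) − d⁺(w)) ≤ 2k; so C u contains
-- them all. Finally a vertex y of X outside C u forces |C u| + 1 ≤ 2k + 2e, with e ≤ k the in- or
-- out-degree of y in A′; choosing y of least A′-degree among the m such vertices also gives m e ≤ 2k,
-- which together with |C u| + m ≥ 4k + 3 is impossible.
module Submission where

open import Defs
open import Data.Nat as ℕ using (ℕ; zero; suc; _+_; _*_; _≤_; _<_; z≤n; s≤s)
open import Data.Fin using (Fin; zero; suc; _≟_)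
open import Data.Fin.Subset using (Subset; _∈_; ∣_∣; _∪_; _∩_; ⁅_⁆; _⊂_)
open import Data.Product using (_×_; _,_; proj₁; proj₂; ∃; swap)

open import Data.Bool as Bool using (Bool; true; false; if_then_else_)
open import Data.Bool.Properties using (∧-conicalˡ; ¬-not)
open import Data.Empty using (⊥; ⊥-elim)
open import Data.Fin.Properties using (any?)
open import Data.Fin.Subset.Properties
  using (_∈?_; ∣p∣≤n; p⊂q⇒∣p∣<∣q∣; p⊆p∪q; q⊆p∪q; x∈p∪q⁻; x∈p∩q⁺; x∈p∩q⁻; x∈⁅x⁆; x∈⁅y⁆⇒x≡y; ∣⁅x⁆∣≡1)
import Data.List as List
open import Data.List.Extrema.Nat using (argmax; argmin; argmax-all; argmin-all; f[xs]≤f[argmax]; f[argmin]≤f[xs])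
open import Data.List.Membership.Propositional using () renaming (_∈_ to _∈ₗ_)
open import Data.List.Membership.Propositional.Properties using (∈-filter⁺; ∈-allFin)
open import Data.List.Properties using (map-tabulate)
import Data.List.Relation.Unary.All as All
open import Data.List.Relation.Unary.All.Properties using (all-filter)
import Data.Nat.ListAction as ListAction
open import Data.Nat.Properties hiding (_≟_)
open import Algebra.Properties.CommutativeMonoid.Sum +-0-commutativeMonoid
  using (∑-comm; ∑-distrib-+; sum-cong-≗) renaming (sum to ∑)
open import Algebra.Properties.Semiring.Sum +-*-semiring using (*-distribʳ-sum)
open import Data.Nat.Tactic.RingSolver using (solve-∀)
open import Data.Sum as Sum using (_⊎_; inj₁; inj₂; [_,_]′)
open import Data.Vec using (tabulate; []; _∷_)
open import Data.Vec.Properties using (lookup⇒[]=; []=⇒lookup; lookup∘tabulate)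
open import Function using (_∘_; id; flip)
open import Level using (0ℓ)
open import Relation.Binary.Construct.Closure.ReflexiveTransitive using (ε; _◅_; _◅◅_)
open import Relation.Binary.PropositionalEquality
open import Relation.Nullary using (Dec; yes; no; does; ¬_; ¬?; _×-dec_; _⊎-dec_; contradiction)
open import Relation.Nullary.Decidable using (map′; dec-true)
open import Relation.Unary using (Pred; Decidable; _⊆_; _≐_)
open import Relation.Unary.Properties using (_∩?_; _∪?_; ∁?)

private variable
  n : ℕ
  A B : Set

indicator : Dec A → ℕ
indicator a? = if does a? then 1 else 0

indicator-mono : (A → B) → (a? : Dec A) (b? : Dec B) → indicator a? ≤ indicator b?
indicator-mono f (yes a) (yes b) = ≤-refl
indicator-mono f (yes a) (no ¬b) = contradiction (f a) ¬b
indicator-mono f (no ¬a) b?      = z≤n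

indicator-split : (a? : Dec A) (b? : Dec B) →
  indicator a? ≡ indicator (a? ×-dec b?) + indicator (a? ×-dec ¬? b?)
indicator-split (yes _) (yes _) = refl
indicator-split (yes _) (no _)  = refl
indicator-split (no _)  b?      = refl

indicator-⊎ : (a? : Dec A) (b? : Dec B) → indicator (a? ⊎-dec b?) ≤ indicator a? + indicator b?
indicator-⊎ (yes _) b? = s≤s z≤n
indicator-⊎ (no _)  b? = ≤-refl

indicator-⊎-disjoint : ¬ (A × B) → (a? : Dec A) (b? : Dec B) →
  indicator (a? ⊎-dec b?) ≡ indicator a? + indicator b?
indicator-⊎-disjoint disjoint (yes a) (yes b) = contradiction (a , b) disjoint
indicator-⊎-disjoint disjoint (yes _) (no _)  = refl
indicator-⊎-disjoint disjoint (no _)  b?      = refl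

∑-mono-≤ : {f g : Fin n → ℕ} → (∀ z → f z ≤ g z) → ∑ f ≤ ∑ g
∑-mono-≤ {zero}  f≤g = z≤n
∑-mono-≤ {suc n} f≤g = +-mono-≤ (f≤g zero) (∑-mono-≤ (f≤g ∘ suc))

f≤∑f : (f : Fin n → ℕ) (z : Fin n) → f z ≤ ∑ f
f≤∑f f zero    = m≤m+n _ _
f≤∑f f (suc z) = ≤-trans (f≤∑f (f ∘ suc) z) (m≤n+m _ _)

count : {P : Pred (Fin n) 0ℓ} → Decidable P → ℕ
count P? = ∑ (indicator ∘ P?)

module _ {P Q : Pred (Fin n) 0ℓ} (P? : Decidable P) (Q? : Decidable Q) where

  count-mono : P ⊆ Q → count P? ≤ count Q?
  count-mono P⊆Q = ∑-mono-≤ λ z → indicator-mono P⊆Q (P? z) (Q? z)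

  count-split : count P? ≡ count (P? ∩? Q?) + count (P? ∩? ∁? Q?)
  count-split = trans (sum-cong-≗ λ z → indicator-split (P? z) (Q? z))
    (∑-distrib-+ (indicator ∘ (P? ∩? Q?)) (indicator ∘ (P? ∩? ∁? Q?)))

  count-∪ : count (P? ∪? Q?) ≤ count P? + count Q?
  count-∪ = ≤-trans (∑-mono-≤ λ z → indicator-⊎ (P? z) (Q? z))
    (≤-reflexive (∑-distrib-+ (indicator ∘ P?) (indicator ∘ Q?)))

  count-∪-disjoint : (∀ {z} → ¬ (P z × Q z)) → count (P? ∪? Q?) ≡ count P? + count Q?
  count-∪-disjoint disjoint = trans (sum-cong-≗ λ z → indicator-⊎-disjoint disjoint (P? z) (Q? z))
    (∑-distrib-+ (indicator ∘ P?) (indicator ∘ Q?))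

count-cong : {P Q : Pred (Fin n) 0ℓ} (P? : Decidable P) (Q? : Decidable Q) → P ≐ Q → count P? ≡ count Q?
count-cong P? Q? (P⊆Q , Q⊆P) = ≤-antisym (count-mono P? Q? P⊆Q) (count-mono Q? P? Q⊆P)

count*c≤∑ : {P : Pred (Fin n) 0ℓ} (P? : Decidable P) {c : ℕ} (g : Fin n → ℕ) →
  (∀ {z} → P z → c ≤ g z) → count P? * c ≤ ∑ g
count*c≤∑ {P = P} P? {c} g c≤g = begin
  count P? * c                ≡⟨ *-distribʳ-sum c (indicator ∘ P?) ⟩
  ∑ (λ z → indicator (P? z) * c) ≤⟨ ∑-mono-≤ (λ z → bound (P? z)) ⟩
  ∑ g                         ∎
  where
  open ≤-Reasoning
  bound : ∀ {z} (pz? : Dec (P z)) → indicator pz? * c ≤ g z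
  bound (yes pz) = ≤-trans (≤-reflexive (+-identityʳ c)) (c≤g pz)
  bound (no _)   = z≤n

module _ {P : Pred (Fin n) 0ℓ} (P? : Decidable P) where

  0<count : ∀ {z} → P z → 0 < count P?
  0<count {z} pz = ≤-trans (≤-reflexive (sym (indicator-yes (P? z)))) (f≤∑f (indicator ∘ P?) z)
    where
    indicator-yes : (pz? : Dec (P z)) → indicator pz? ≡ 1
    indicator-yes (yes _)  = refl
    indicator-yes (no ¬pz) = contradiction pz ¬pz

  count≡0⇒∅ : count P? ≡ 0 → ∀ {z} → ¬ P z
  count≡0⇒∅ count≡0 pz = <⇒≢ (0<count pz) (sym count≡0)

0<count⇒∃ : {P : Pred (Fin n) 0ℓ} (P? : Decidable P) → 0 < count P? → ∃ P
0<count⇒∃ {zero}  P? ()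
0<count⇒∃ {suc n} P? pos with P? zero
... | yes p0 = zero , p0
... | no _   = let z , pz = 0<count⇒∃ (P? ∘ suc) pos in suc z , pz

module _ {P : Pred (Fin n) 0ℓ} (P? : Decidable P) (f : Fin n → ℕ) where

  private
    candidates : List.List (Fin n)
    candidates = List.filter P? (List.allFin n)

    candidate : ∀ {z} → P z → z ∈ₗ candidates
    candidate = ∈-filter⁺ P? (∈-allFin _)

  maximiser : ∃ P → ∃ λ u → P u × (∀ {z} → P z → f z ≤ f u)
  maximiser (w , pw) = argmax f w candidates
    , argmax-all f pw (all-filter P? (List.allFin n))
    , λ pz → All.lookup (f[xs]≤f[argmax] w candidates) (candidate pz)

  minimiser : ∃ P → ∃ λ u → P u × (∀ {z} → P z → f u ≤ f z)
  minimiser (w , pw) = argmin f w candidates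
    , argmin-all f pw (all-filter P? (List.allFin n))
    , λ pz → All.lookup (f[argmin]≤f[xs] w candidates) (candidate pz)

∣p∣≡count∈ : (p : Subset n) → ∣ p ∣ ≡ count (_∈? p)
∣p∣≡count∈ []          = refl
∣p∣≡count∈ (true ∷ p)  = cong suc (∣p∣≡count∈ p)
∣p∣≡count∈ (false ∷ p) = ∣p∣≡count∈ p

count-singleton : (y : Fin n) → count (_≟ y) ≡ 1
count-singleton y = begin
  count (_≟ y)      ≡⟨ count-cong (_≟ y) (_∈? ⁅ y ⁆) ((λ { refl → x∈⁅x⁆ y }) , x∈⁅y⁆⇒x≡y y) ⟩
  count (_∈? ⁅ y ⁆) ≡⟨ sym (∣p∣≡count∈ ⁅ y ⁆) ⟩
  ∣ ⁅ y ⁆ ∣         ≡⟨ ∣⁅x⁆∣≡1 y ⟩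
  1                 ∎
  where open ≡-Reasoning

module _ {f : Fin n → Bool} {x : Fin n} where

  ∈-tabulate⁺ : f x ≡ true → x ∈ tabulate f
  ∈-tabulate⁺ fx = lookup⇒[]= x (tabulate f) (trans (lookup∘tabulate f x) fx)

  ∈-tabulate⁻ : x ∈ tabulate f → f x ≡ true
  ∈-tabulate⁻ x∈f = trans (sym (lookup∘tabulate f x)) ([]=⇒lookup x∈f)

∣tabulate∣≡count : (f : Fin n → Bool) → ∣ tabulate f ∣ ≡ count (λ z → f z Bool.≟ true)
∣tabulate∣≡count f = trans (∣p∣≡count∈ (tabulate f))
  (count-cong (_∈? tabulate f) (λ z → f z Bool.≟ true) (∈-tabulate⁻ , ∈-tabulate⁺))

module _ {P : Pred (Fin n) 0ℓ} (P? : Decidable P) where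

  toSubset : Subset n
  toSubset = tabulate (does ∘ P?)

  ∈-toSubset⁺ : ∀ {z} → P z → z ∈ toSubset
  ∈-toSubset⁺ {z} pz = ∈-tabulate⁺ (dec-true (P? z) pz)

  ∈-toSubset⁻ : ∀ {z} → z ∈ toSubset → P z
  ∈-toSubset⁻ {z} z∈P = witness (P? z) (∈-tabulate⁻ z∈P)
    where
    witness : (pz? : Dec (P z)) → does pz? ≡ true → P z
    witness (yes pz) _ = pz

  ∣toSubset∩tabulate∣ : (f : Fin n → Bool) →
    ∣ toSubset ∩ tabulate f ∣ ≡ count (P? ∩? λ z → f z Bool.≟ true)
  ∣toSubset∩tabulate∣ f = trans (∣p∣≡count∈ (toSubset ∩ tabulate f))
    (count-cong (_∈? toSubset ∩ tabulate f) (P? ∩? λ z → f z Bool.≟ true)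
      ( (λ z∈ → let z∈P , z∈f = x∈p∩q⁻ toSubset (tabulate f) z∈ in ∈-toSubset⁻ z∈P , ∈-tabulate⁻ z∈f)
      , (λ (pz , fz) → x∈p∩q⁺ (∈-toSubset⁺ pz , ∈-tabulate⁺ fz))))

Arc : Digraph n → Fin n → Fin n → Set
Arc D x y = D x y ≡ true

arc? : (D : Digraph n) (x y : Fin n) → Dec (Arc D x y)
arc? D x y = D x y Bool.≟ true

indeg : Digraph n → Fin n → ℕ
indeg D x = ∣ inNbrs D x ∣

degree : Digraph n → Fin n → ℕ
degree D x = outdeg D x + indeg D x

Isolated : Digraph n → Fin n → Set
Isolated D v = (∀ {z} → ¬ Arc D v z) × (∀ {z} → ¬ Arc D z v)

outdeg≡count : (D : Digraph n) (x : Fin n) → outdeg D x ≡ count (arc? D x)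
outdeg≡count D x = ∣tabulate∣≡count (D x)

indeg≡count : (D : Digraph n) (x : Fin n) → indeg D x ≡ count (λ z → arc? D z x)
indeg≡count D x = ∣tabulate∣≡count (λ z → D z x)

sum-tabulate : (f : Fin n → ℕ) → ListAction.sum (List.tabulate f) ≡ ∑ f
sum-tabulate {zero}  f = refl
sum-tabulate {suc n} f = cong (f zero +_) (sum-tabulate (f ∘ suc))

module _ (D : Digraph n) where

  ∑outdeg≡numArcs : ∑ (outdeg D) ≡ numArcs D
  ∑outdeg≡numArcs = sym (trans (cong ListAction.sum (map-tabulate id (outdeg D))) (sum-tabulate (outdeg D)))

  ∑indeg≡∑outdeg : ∑ (indeg D) ≡ ∑ (outdeg D)
  ∑indeg≡∑outdeg = begin
    ∑ (indeg D)                        ≡⟨ sum-cong-≗ (indeg≡count D) ⟩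
    ∑ (λ y → count (λ x → arc? D x y)) ≡⟨ sym (∑-comm (λ x y → indicator (arc? D x y))) ⟩
    ∑ (λ x → count (arc? D x))         ≡⟨ sum-cong-≗ (sym ∘ outdeg≡count D) ⟩
    ∑ (outdeg D)                       ∎
    where open ≡-Reasoning

  ∑degree≡2*numArcs : ∑ (degree D) ≡ 2 * numArcs D
  ∑degree≡2*numArcs = begin
    ∑ (degree D)                ≡⟨ ∑-distrib-+ (outdeg D) (indeg D) ⟩
    ∑ (outdeg D) + ∑ (indeg D)  ≡⟨ cong (∑ (outdeg D) +_) ∑indeg≡∑outdeg ⟩
    ∑ (outdeg D) + ∑ (outdeg D) ≡⟨ cong₂ _+_ ∑outdeg≡numArcs (trans ∑outdeg≡numArcs (sym (+-identityʳ _))) ⟩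
    2 * numArcs D               ∎
    where open ≡-Reasoning

  outdeg≤numArcs : ∀ x → outdeg D x ≤ numArcs D
  outdeg≤numArcs x = ≤-trans (f≤∑f (outdeg D) x) (≤-reflexive ∑outdeg≡numArcs)

  indeg≤numArcs : ∀ x → indeg D x ≤ numArcs D
  indeg≤numArcs x = ≤-trans (f≤∑f (indeg D) x) (≤-reflexive (trans ∑indeg≡∑outdeg ∑outdeg≡numArcs))

  count-degree≢0 : count (∁? λ z → degree D z ℕ.≟ 0) ≤ 2 * numArcs D
  count-degree≢0 = begin
    count (∁? λ z → degree D z ℕ.≟ 0)     ≡⟨ sym (*-identityʳ _) ⟩
    count (∁? λ z → degree D z ℕ.≟ 0) * 1 ≤⟨ count*c≤∑ (∁? λ z → degree D z ℕ.≟ 0) (degree D) n≢0⇒n>0 ⟩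
    ∑ (degree D)                          ≡⟨ ∑degree≡2*numArcs ⟩
    2 * numArcs D                         ∎
    where open ≤-Reasoning

  degree≡0⇒isolated : ∀ {v} → degree D v ≡ 0 → Isolated D v
  degree≡0⇒isolated {v} degree≡0 =
      count≡0⇒∅ (arc? D v) (trans (sym (outdeg≡count D v)) (m+n≡0⇒m≡0 _ degree≡0))
    , count≡0⇒∅ (λ z → arc? D z v) (trans (sym (indeg≡count D v)) (m+n≡0⇒n≡0 (outdeg D v) degree≡0))

module Tournament {T : Digraph n} (tournament : IsTournament T) where

  loopless : ∀ {x} → ¬ Arc T x x
  loopless {x} txx = contradiction (trans (sym (proj₁ tournament x)) txx) λ ()

  complete : ∀ {x y} → x ≢ y → ¬ Arc T x y → Arc T y x
  complete {x} {y} x≢y ¬txy with T x y | T y x | proj₂ tournament x y x≢y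
  ... | true  | _    | _ = contradiction refl ¬txy
  ... | false | true | _ = refl

  asymmetric : ∀ {x y} → Arc T x y → ¬ Arc T y x
  asymmetric {x} {y} txy tyx with proj₂ tournament x y (λ { refl → loopless txy })
  ... | exactly-one rewrite txy | tyx = contradiction exactly-one λ ()

module _ (D : Digraph n) where

  Closed : Subset n → Set
  Closed R = ∀ {x y} → x ∈ R → Arc D x y → y ∈ R

  closed⇒reach-closed : ∀ {R x z} → Closed R → x ∈ R → Reach D x z → z ∈ R
  closed⇒reach-closed closed x∈R ε         = x∈R
  closed⇒reach-closed closed x∈R (xy ◅ yz) = closed⇒reach-closed closed (closed x∈R xy) yz

  module _ (v : Fin n) where

    Explored : Subset n → Set
    Explored R = v ∈ R × (∀ {z} → z ∈ R → Reach D v z)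

    ReachableSet : Set
    ReachableSet = ∃ λ R → Explored R × Closed R

    -- Each step adds an out-neighbour of R lying outside R, so ∣ R ∣ grows; the fuel bound makes
    -- running out of fuel with R still open contradict ∣ R ∣ ≤ n.
    explore : (fuel : ℕ) (R : Subset n) → n ≤ ∣ R ∣ + fuel → Explored R → ReachableSet
    explore fuel R bound explored@(v∈R , sound)
      with any? (λ x → any? (λ y → x ∈? R ×-dec ¬? (y ∈? R) ×-dec arc? D x y))
    ... | no ¬escape = R , explored , closed
      where
      closed : Closed R
      closed {x} {y} x∈R xy with y ∈? R
      ... | yes y∈R = y∈R
      ... | no y∉R  = contradiction (x , y , x∈R , y∉R , xy) ¬escape
    ... | yes (x , y , x∈R , y∉R , xy) = extend fuel bound
      where
      R⊂R′ : R ⊂ R ∪ ⁅ y ⁆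
      R⊂R′ = p⊆p∪q ⁅ y ⁆ , y , q⊆p∪q R ⁅ y ⁆ (x∈⁅x⁆ y) , y∉R

      sound′ : ∀ {z} → z ∈ R ∪ ⁅ y ⁆ → Reach D v z
      sound′ z∈R′ with x∈p∪q⁻ R ⁅ y ⁆ z∈R′
      ... | inj₁ z∈R   = sound z∈R
      ... | inj₂ z∈⁅y⁆ rewrite x∈⁅y⁆⇒x≡y y z∈⁅y⁆ = sound x∈R ◅◅ xy ◅ ε

      extend : (fuel : ℕ) → n ≤ ∣ R ∣ + fuel → ReachableSet
      extend zero bound = contradiction (subst (n ≤_) (+-identityʳ _) bound)
        (<⇒≱ (<-≤-trans (p⊂q⇒∣p∣<∣q∣ R⊂R′) (∣p∣≤n (R ∪ ⁅ y ⁆))))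
      extend (suc fuel) bound = explore fuel (R ∪ ⁅ y ⁆)
        (≤-trans bound (≤-trans (≤-reflexive (+-suc _ fuel)) (+-monoˡ-≤ fuel (p⊂q⇒∣p∣<∣q∣ R⊂R′))))
        (p⊆p∪q ⁅ y ⁆ v∈R , sound′)

    reachableSet : ReachableSet
    reachableSet = explore n ⁅ v ⁆ (subst (λ c → n ≤ c + n) (sym (∣⁅x⁆∣≡1 v)) (n≤1+n n))
      (x∈⁅x⁆ v , λ z∈⁅v⁆ → subst (Reach D v) (sym (x∈⁅y⁆⇒x≡y v z∈⁅v⁆)) ε)

  -- Opaque: unfolding the search during unification makes type checking blow up.
  opaque
    reach? : (x y : Fin n) → Dec (Reach D x y)
    reach? x y with reachableSet x
    ... | R , (x∈R , sound) , closed = map′ sound (closed⇒reach-closed closed x∈R) (y ∈? R)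

module Components (D : Digraph n) where

  Component Below : Fin n → Pred (Fin n) 0ℓ
  Component v z = Reach D v z × Reach D z v
  Below v z     = Reach D v z × ¬ Reach D z v

  reaches? : (v : Fin n) → Decidable (Reach D v)
  reaches? = reach? D

  reached? : (v : Fin n) → Decidable (λ z → Reach D z v)
  reached? v z = reach? D z v

  component? : (v : Fin n) → Decidable (Component v)
  component? v = reaches? v ∩? reached? v

  below? : (v : Fin n) → Decidable (Below v)
  below? v = reaches? v ∩? ∁? (reached? v)

  component-isStrongComponent : (v : Fin n) → IsStrongComponentOf D (toSubset (component? v)) v
  component-isStrongComponent v =
    ∈-toSubset⁺ (component? v) (ε , ε) , λ u → ∈-toSubset⁻ (component? v) , ∈-toSubset⁺ (component? v)

  component-balanced : ∀ {v} → IsEulerianOn D (toSubset (component? v)) →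
    count (component? v ∩? arc? D v) ≡ count (component? v ∩? λ z → arc? D z v)
  component-balanced {v} (_ , balanced) = begin
    count (component? v ∩? arc? D v)          ≡⟨ sym (∣toSubset∩tabulate∣ (component? v) (D v)) ⟩
    ∣ toSubset (component? v) ∩ outNbrs D v ∣ ≡⟨ balanced v (∈-toSubset⁺ (component? v) (ε , ε)) ⟩
    ∣ toSubset (component? v) ∩ inNbrs D v ∣  ≡⟨ ∣toSubset∩tabulate∣ (component? v) (λ z → D z v) ⟩
    count (component? v ∩? λ z → arc? D z v)  ∎
    where open ≡-Reasoning

  count-reaches : ∀ v → count (reaches? v) ≡ count (component? v) + count (below? v)
  count-reaches v = count-split (reaches? v) (reached? v)

  count-below-of-below : ∀ {u w} → Below u w →
    count (below? u) ≡ count (reaches? w) + count (below? u ∩? ∁? (reaches? w))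
  count-below-of-below {u} {w} (uw , ¬wu) = trans (count-split (below? u) (reaches? w))
    (cong (_+ count (below? u ∩? ∁? (reaches? w)))
      (count-cong (below? u ∩? reaches? w) (reaches? w) (proj₂ , λ wz → (uw ◅◅ wz , λ zu → ¬wu (wz ◅◅ zu)) , wz)))

module ArcDeletion (T A′ : Digraph n) where

  open Components (T − A′) public

  private
    D = T − A′

  module _ {x y : Fin n} where

    −-arc⁺ : Arc T x y → ¬ Arc A′ x y → Arc D x y
    −-arc⁺ txy ¬axy rewrite txy | ¬-not ¬axy = refl

    −-arc⁻ : Arc D x y → Arc T x y
    −-arc⁻ = ∧-conicalˡ (T x y) _

  module _ (tournament : IsTournament T) where

    open Tournament {T = T} tournament

    count-reaches≤outdeg+indeg : ∀ {v y} → ¬ Reach D v y → count (reaches? v) ≤ outdeg T y + indeg A′ y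
    count-reaches≤outdeg+indeg {v} {y} ¬vy = begin
      count (reaches? v)              ≤⟨ count-mono (reaches? v) (arc? T y ∪? in-A′?) cover ⟩
      count (arc? T y ∪? in-A′?)      ≤⟨ count-∪ (arc? T y) in-A′? ⟩
      count (arc? T y) + count in-A′? ≡⟨ sym (cong₂ _+_ (outdeg≡count T y) (indeg≡count A′ y)) ⟩
      outdeg T y + indeg A′ y         ∎
      where
      open ≤-Reasoning
      in-A′? = λ z → arc? A′ z y
      cover : ∀ {z} → Reach D v z → Arc T y z ⊎ Arc A′ z y
      cover {z} vz with arc? T y z | arc? A′ z y
      ... | yes tyz | _       = inj₁ tyz
      ... | no _    | yes azy = inj₂ azy
      ... | no ¬tyz | no ¬azy = contradiction (vz ◅◅ −-arc⁺ (complete y≢z ¬tyz) ¬azy ◅ ε) ¬vy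
        where
        y≢z : y ≢ z
        y≢z refl = ¬vy vz

    outdeg+1≤count-below+outdeg : ∀ {v y} → Below v y → outdeg T y + 1 ≤ count (below? v) + outdeg A′ y
    outdeg+1≤count-below+outdeg {v} {y} (vy , ¬yv) = begin
      outdeg T y + 1                       ≡⟨ cong₂ _+_ (outdeg≡count T y) (sym (count-singleton y)) ⟩
      count (arc? T y) + count (_≟ y)      ≡⟨ sym (count-∪-disjoint (arc? T y) (_≟ y) λ { (tyy , refl) → loopless tyy }) ⟩
      count (arc? T y ∪? (_≟ y))           ≤⟨ count-mono (arc? T y ∪? (_≟ y)) (below? v ∪? arc? A′ y) cover ⟩
      count (below? v ∪? arc? A′ y)        ≤⟨ count-∪ (below? v) (arc? A′ y) ⟩
      count (below? v) + count (arc? A′ y) ≡⟨ cong (count (below? v) +_) (sym (outdeg≡count A′ y)) ⟩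
      count (below? v) + outdeg A′ y       ∎
      where
      open ≤-Reasoning
      cover : ∀ {z} → Arc T y z ⊎ z ≡ y → Below v z ⊎ Arc A′ y z
      cover (inj₂ refl) = inj₁ (vy , ¬yv)
      cover {z} (inj₁ tyz) with arc? A′ y z
      ... | yes ayz = inj₂ ayz
      ... | no ¬ayz = inj₁ (vy ◅◅ dyz ◅ ε , λ zv → ¬yv (dyz ◅ zv))
        where dyz = −-arc⁺ tyz ¬ayz

    module _ {v : Fin n} (isolated : Isolated A′ v) where

      isolated-adjacent : ∀ {z} → z ≢ v → Arc D v z ⊎ Arc D z v
      isolated-adjacent {z} z≢v with arc? T v z
      ... | yes tvz = inj₁ (−-arc⁺ tvz (proj₁ isolated))
      ... | no ¬tvz = inj₂ (−-arc⁺ (complete (z≢v ∘ sym) ¬tvz) (proj₂ isolated))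

      isolated-comparable : ∀ z → Reach D v z ⊎ Reach D z v
      isolated-comparable z with z ≟ v
      ... | yes refl = inj₁ ε
      ... | no z≢v   = Sum.map (_◅ ε) (_◅ ε) (isolated-adjacent z≢v)

      below-isolated⇒arc : ∀ {z} → Below v z → Arc D v z
      below-isolated⇒arc {z} (_ , ¬zv) with z ≟ v
      ... | yes refl = contradiction ε ¬zv
      ... | no z≢v   = [ id , (λ dzv → contradiction (dzv ◅ ε) ¬zv) ]′ (isolated-adjacent z≢v)

      count-out-isolated : count (arc? T v) ≡ count (component? v ∩? arc? D v) + count (below? v)
      count-out-isolated = begin
        count (arc? T v)  ≡⟨ count-cong (arc? T v) (arc? D v) ((λ tvz → −-arc⁺ tvz (proj₁ isolated)) , −-arc⁻) ⟩
        count (arc? D v)  ≡⟨ count-split (arc? D v) (component? v) ⟩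
        count (arc? D v ∩? component? v) + count (arc? D v ∩? ∁? (component? v))
          ≡⟨ cong₂ _+_ (count-cong (arc? D v ∩? component? v) (component? v ∩? arc? D v) (swap , swap))
                       (count-cong (arc? D v ∩? ∁? (component? v)) (below? v)
                         ( (λ (dvz , ¬c) → dvz ◅ ε , λ zv → ¬c (dvz ◅ ε , zv))
                         , (λ b → below-isolated⇒arc b , λ (_ , zv) → proj₂ b zv))) ⟩
        count (component? v ∩? arc? D v) + count (below? v) ∎
        where open ≡-Reasoning

      count-component-isolated :
        count (component? v) ≡ count (component? v ∩? arc? D v) + count (component? v ∩? λ z → arc? D z v) + 1
      count-component-isolated = begin
        count C                                         ≡⟨ count-split C (arc? D v) ⟩
        count (C ∩? arc? D v) + count (C ∩? ∁? (arc? D v))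
          ≡⟨ cong (count (C ∩? arc? D v) +_) (count-split (C ∩? ∁? (arc? D v)) in?) ⟩
        count (C ∩? arc? D v) + (count ((C ∩? ∁? (arc? D v)) ∩? in?) + count ((C ∩? ∁? (arc? D v)) ∩? ∁? in?))
          ≡⟨ cong (count (C ∩? arc? D v) +_) (cong₂ _+_ only-in only-v) ⟩
        count (C ∩? arc? D v) + (count (C ∩? in?) + 1) ≡⟨ +-assoc (count (C ∩? arc? D v)) _ 1 ⟨
        count (C ∩? arc? D v) + count (C ∩? in?) + 1   ∎
        where
        open ≡-Reasoning
        C = component? v
        in? = λ z → arc? D z v

        only-in : count ((C ∩? ∁? (arc? D v)) ∩? in?) ≡ count (C ∩? in?)
        only-in = count-cong ((C ∩? ∁? (arc? D v)) ∩? in?) (C ∩? in?)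
          ( (λ ((c , _) , dzv) → c , dzv)
          , (λ (c , dzv) → (c , λ dvz → asymmetric (−-arc⁻ dvz) (−-arc⁻ dzv)) , dzv))

        only-v : count ((C ∩? ∁? (arc? D v)) ∩? ∁? in?) ≡ 1
        only-v = trans (count-cong ((C ∩? ∁? (arc? D v)) ∩? ∁? in?) (_≟ v)
                                   (⊆v , λ { refl → ((ε , ε) , ¬loop) , ¬loop }))
                       (count-singleton v)
          where
          ¬loop : ¬ Arc D v v
          ¬loop = loopless ∘ −-arc⁻
          ⊆v : ∀ {z} → (Component v z × ¬ Arc D v z) × ¬ Arc D z v → z ≡ v
          ⊆v {z} ((_ , ¬dvz) , ¬dzv) with z ≟ v
          ... | yes z≡v = z≡v
          ... | no z≢v  = contradiction (isolated-adjacent z≢v) [ ¬dvz , ¬dzv ]′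

      -- C v consists of v, its out-neighbours and its in-neighbours (equally many, by balance); the
      -- remaining out-neighbours of v are exactly the vertices strictly below v.
      outdeg-isolated : IsEulerianOn D (toSubset (component? v)) →
        2 * outdeg T v + 1 ≡ count (component? v) + 2 * count (below? v)
      outdeg-isolated eulerian = begin
        2 * outdeg T v + 1           ≡⟨ cong (λ d → 2 * d + 1) (trans (outdeg≡count T v) count-out-isolated) ⟩
        2 * (a + b) + 1              ≡⟨ rearrange a b ⟩
        a + a + 1 + 2 * b            ≡⟨ cong (_+ 2 * b) count-C ⟨
        count (component? v) + 2 * b ∎
        where
        open ≡-Reasoning
        a = count (component? v ∩? arc? D v)
        b = count (below? v)
        count-C : count (component? v) ≡ a + a + 1
        count-C = trans count-component-isolated (cong (λ i → a + i + 1) (sym (component-balanced eulerian)))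
        rearrange : ∀ a b → 2 * (a + b) + 1 ≡ a + a + 1 + 2 * b
        rearrange = solve-∀

private
  2k+4≤2e+m : ∀ k c m e → c + 1 ≤ 2 * k + 2 * e → 4 * k + 3 ≤ c + m → 2 * k + 4 ≤ 2 * e + m
  2k+4≤2e+m k c m e c-small cm-large = +-cancelˡ-≤ (c + 2 * k) _ _ (begin
    c + 2 * k + (2 * k + 4)   ≡⟨ regroup c k ⟩
    (4 * k + 3) + (c + 1)     ≤⟨ +-mono-≤ cm-large c-small ⟩
    (c + m) + (2 * k + 2 * e) ≡⟨ regroup′ c m k e ⟩
    c + 2 * k + (2 * e + m)   ∎)
    where
    open ≤-Reasoning
    regroup : ∀ c k → c + 2 * k + (2 * k + 4) ≡ (4 * k + 3) + (c + 1)
    regroup = solve-∀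
    regroup′ : ∀ c m k e → (c + m) + (2 * k + 2 * e) ≡ c + 2 * k + (2 * e + m)
    regroup′ = solve-∀

  straggler-arithmetic : ∀ {k} c m e → 2 * k + 3 ≤ c → c + 1 ≤ 2 * k + 2 * e → 4 * k + 3 ≤ c + m →
    e ≤ k → 1 ≤ m → m * e ≤ 2 * k → ⊥
  straggler-arithmetic c 0 e _ _ _ _ () _
  straggler-arithmetic {k} c 1 e _ c-small cm-large e≤k _ _ =
    contradiction (+-cancelˡ-≤ (2 * k) 4 1 (begin
      2 * k + 4 ≤⟨ 2k+4≤2e+m k c 1 e c-small cm-large ⟩
      2 * e + 1 ≤⟨ +-monoˡ-≤ 1 (*-monoʳ-≤ 2 e≤k) ⟩
      2 * k + 1 ∎)) λ { (s≤s ()) }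
    where open ≤-Reasoning
  straggler-arithmetic {k} c m 0 c-large c-small _ _ _ _ =
    contradiction (+-cancelˡ-≤ (2 * k) 4 0 (begin
      2 * k + 4     ≡⟨ +-assoc (2 * k) 3 1 ⟨
      2 * k + 3 + 1 ≤⟨ +-monoˡ-≤ 1 c-large ⟩
      c + 1         ≤⟨ c-small ⟩
      2 * k + 0     ∎)) λ ()
    where open ≤-Reasoning
  straggler-arithmetic {k} c (suc (suc m)) (suc e) _ c-small cm-large _ _ me≤2k =
    contradiction (+-cancelˡ-≤ (2 * k) 4 2 (begin
      2 * k + 4                       ≤⟨ 2k+4≤2e+m k c (suc (suc m)) (suc e) c-small cm-large ⟩
      2 * suc e + suc (suc m)         ≤⟨ m≤m+n _ (m * e) ⟩
      2 * suc e + suc (suc m) + m * e ≡⟨ expand m e ⟩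
      suc (suc m) * suc e + 2         ≤⟨ +-monoˡ-≤ 2 me≤2k ⟩
      2 * k + 2                       ∎)) λ { (s≤s (s≤s ())) }
    where
    open ≤-Reasoning
    expand : ∀ m e → 2 * suc e + suc (suc m) + m * e ≡ suc (suc m) * suc e + 2
    expand = solve-∀

module Lemma2 {T : Digraph n} (tournament : IsTournament T) {A′ : Digraph n} (desc : IsDESC T A′)
              {k : ℕ} (few-arcs : numArcs A′ ≤ k) {X : Subset n}
              (spread : ∀ {x y} → x ∈ X → y ∈ X → outdeg T x ≤ outdeg T y + k) where

  open ArcDeletion T A′

  private
    D = T − A′

  outdeg-formula : ∀ {v} → Isolated A′ v → 2 * outdeg T v + 1 ≡ count (component? v) + 2 * count (below? v)
  outdeg-formula {v} isolated = outdeg-isolated tournament isolated (desc v _ (component-isStrongComponent v))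

  outdeg-gap : ∀ {u w} → Isolated A′ u → Isolated A′ w → Below u w →
    2 * outdeg T u ≡ 2 * outdeg T w + count (component? u) + count (component? w)
                     + 2 * count (below? u ∩? ∁? (reaches? w))
  outdeg-gap {u} {w} iu iw uw = +-cancelʳ-≡ 1 _ _ (begin
    2 * outdeg T u + 1                       ≡⟨ outdeg-formula iu ⟩
    cu + 2 * count (below? u)                ≡⟨ cong (λ b → cu + 2 * b) count-below-u ⟩
    cu + 2 * (cw + bw + m)                   ≡⟨ regroup cu cw bw m ⟩
    (cw + 2 * bw) + (cu + cw + 2 * m)        ≡⟨ cong (_+ (cu + cw + 2 * m)) (outdeg-formula iw) ⟨
    (2 * outdeg T w + 1) + (cu + cw + 2 * m) ≡⟨ regroup′ (outdeg T w) cu cw m ⟩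
    2 * outdeg T w + cu + cw + 2 * m + 1     ∎)
    where
    open ≡-Reasoning
    cu = count (component? u)
    cw = count (component? w)
    bw = count (below? w)
    m  = count (below? u ∩? ∁? (reaches? w))
    count-below-u : count (below? u) ≡ cw + bw + m
    count-below-u = trans (count-below-of-below uw) (cong (_+ m) (count-reaches w))
    regroup : ∀ cu cw bw m → cu + 2 * (cw + bw + m) ≡ (cw + 2 * bw) + (cu + cw + 2 * m)
    regroup = solve-∀
    regroup′ : ∀ ow cu cw m → (2 * ow + 1) + (cu + cw + 2 * m) ≡ 2 * ow + cu + cw + 2 * m + 1
    regroup′ = solve-∀

  below⇒outdeg< : ∀ {u w} → Isolated A′ u → Isolated A′ w → Below u w → outdeg T w < outdeg T u
  below⇒outdeg< {u} {w} iu iw uw = *-cancelˡ-< 2 (outdeg T w) (outdeg T u) (begin-strict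
    2 * outdeg T w                        <⟨ m<m+n _ (0<count (component? u) (ε , ε)) ⟩
    2 * outdeg T w + count (component? u) ≤⟨ ≤-trans (m≤m+n _ _) (m≤m+n _ _) ⟩
    2 * outdeg T w + count (component? u) + count (component? w) + 2 * count (below? u ∩? ∁? (reaches? w))
                                          ≡⟨ outdeg-gap iu iw uw ⟨
    2 * outdeg T u                        ∎)
    where open ≤-Reasoning

  component-bound : ∀ {v y} → Isolated A′ v → v ∈ X → y ∈ X → ¬ Component v y →
    count (component? v) + 1 ≤ 2 * k + 2 * indeg A′ y ⊎ count (component? v) + 1 ≤ 2 * k + 2 * outdeg A′ y
  component-bound {v} {y} iv v∈X y∈X ¬cvy with isolated-comparable tournament iv y
  ... | inj₂ yv = inj₁ (+-cancelˡ-≤ (c + 2 * b) _ _ (begin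
    (c + 2 * b) + (c + 1)         ≡⟨ regroup c b ⟩
    2 * (c + b) + 1               ≤⟨ +-monoˡ-≤ 1 (*-monoʳ-≤ 2 (≤-trans reach≤ (+-monoˡ-≤ e (spread y∈X v∈X)))) ⟩
    2 * (o + k + e) + 1           ≡⟨ regroup′ o k e ⟩
    (2 * o + 1) + (2 * k + 2 * e) ≡⟨ cong (_+ (2 * k + 2 * e)) (outdeg-formula iv) ⟩
    (c + 2 * b) + (2 * k + 2 * e) ∎))
    where
    open ≤-Reasoning
    c = count (component? v)
    b = count (below? v)
    o = outdeg T v
    e = indeg A′ y
    reach≤ : c + b ≤ outdeg T y + e
    reach≤ = subst (_≤ outdeg T y + e) (count-reaches v)
                   (count-reaches≤outdeg+indeg tournament λ vy → ¬cvy (vy , yv))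
    regroup : ∀ c b → (c + 2 * b) + (c + 1) ≡ 2 * (c + b) + 1
    regroup = solve-∀
    regroup′ : ∀ o k e → 2 * (o + k + e) + 1 ≡ (2 * o + 1) + (2 * k + 2 * e)
    regroup′ = solve-∀
  ... | inj₁ vy = inj₂ (+-cancelˡ-≤ (2 * b) _ _ (begin
    2 * b + (c + 1)         ≡⟨ regroup b c ⟩
    (c + 2 * b) + 1         ≡⟨ cong (_+ 1) (outdeg-formula iv) ⟨
    2 * o + 1 + 1           ≡⟨ +-assoc (2 * o) 1 1 ⟩
    2 * o + 2               ≤⟨ +-monoˡ-≤ 2 (*-monoʳ-≤ 2 (spread v∈X y∈X)) ⟩
    2 * (o′ + k) + 2        ≡⟨ regroup′ o′ k ⟩
    2 * (o′ + 1) + 2 * k    ≤⟨ +-monoˡ-≤ (2 * k) (*-monoʳ-≤ 2 out≤) ⟩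
    2 * (b + e) + 2 * k     ≡⟨ regroup″ b e k ⟩
    2 * b + (2 * k + 2 * e) ∎))
    where
    open ≤-Reasoning
    c  = count (component? v)
    b  = count (below? v)
    o  = outdeg T v
    o′ = outdeg T y
    e  = outdeg A′ y
    out≤ : o′ + 1 ≤ b + e
    out≤ = outdeg+1≤count-below+outdeg tournament (vy , λ yv → ¬cvy (vy , yv))
    regroup : ∀ b c → 2 * b + (c + 1) ≡ (c + 2 * b) + 1
    regroup = solve-∀
    regroup′ : ∀ o′ k → 2 * (o′ + k) + 2 ≡ 2 * (o′ + 1) + 2 * k
    regroup′ = solve-∀
    regroup″ : ∀ b e k → 2 * (b + e) + 2 * k ≡ 2 * b + (2 * k + 2 * e)
    regroup″ = solve-∀

  Clean : Pred (Fin n) 0ℓ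
  Clean z = z ∈ X × degree A′ z ≡ 0

  clean? : Decidable Clean
  clean? = (_∈? X) ∩? λ z → degree A′ z ℕ.≟ 0

  clean-isolated : ∀ {z} → Clean z → Isolated A′ z
  clean-isolated = degree≡0⇒isolated A′ ∘ proj₂

  module _ (large : 4 * k + 3 ≤ ∣ X ∣) where

    count-clean : 2 * k + 3 ≤ count clean?
    count-clean = +-cancelʳ-≤ (2 * k) _ _ (begin
      2 * k + 3 + 2 * k                              ≡⟨ regroup k ⟩
      4 * k + 3                                      ≤⟨ large ⟩
      ∣ X ∣                                          ≡⟨ ∣p∣≡count∈ X ⟩
      count (_∈? X)                                  ≡⟨ count-split (_∈? X) isolated? ⟩
      count clean? + count ((_∈? X) ∩? ∁? isolated?) ≤⟨ +-monoʳ-≤ (count clean?) touched≤2k ⟩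
      count clean? + 2 * k                           ∎)
      where
      open ≤-Reasoning
      isolated? = λ z → degree A′ z ℕ.≟ 0
      touched≤2k : count ((_∈? X) ∩? ∁? isolated?) ≤ 2 * k
      touched≤2k = ≤-trans (count-mono ((_∈? X) ∩? ∁? isolated?) (∁? isolated?) proj₂)
                           (≤-trans (count-degree≢0 A′) (*-monoʳ-≤ 2 few-arcs))
      regroup : ∀ k → 2 * k + 3 + 2 * k ≡ 4 * k + 3
      regroup = solve-∀

    private
      clean-exists : ∃ Clean
      clean-exists = 0<count⇒∃ clean? (≤-trans (s≤s z≤n) (≤-trans (m≤n+m 3 (2 * k)) count-clean))

    -- Opaque for the same reason as reach?.
    opaque
      top bottom : Fin n
      top    = proj₁ (maximiser clean? (outdeg T) clean-exists)
      bottom = proj₁ (minimiser clean? (outdeg T) clean-exists)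

      top-clean : Clean top
      top-clean = proj₁ (proj₂ (maximiser clean? (outdeg T) clean-exists))

      bottom-clean : Clean bottom
      bottom-clean = proj₁ (proj₂ (minimiser clean? (outdeg T) clean-exists))

      top-maximal : ∀ {z} → Clean z → outdeg T z ≤ outdeg T top
      top-maximal = proj₂ (proj₂ (maximiser clean? (outdeg T) clean-exists))

      bottom-minimal : ∀ {z} → Clean z → outdeg T bottom ≤ outdeg T z
      bottom-minimal = proj₂ (proj₂ (minimiser clean? (outdeg T) clean-exists))

    top-reaches-clean : ∀ {z} → Clean z → Reach D top z
    top-reaches-clean {z} cz with reaches? top z
    ... | yes uz = uz
    ... | no ¬uz = contradiction (top-maximal cz)
                     (<⇒≱ (below⇒outdeg< (clean-isolated cz) (clean-isolated top-clean) (zu , ¬uz)))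
      where
      zu : Reach D z top
      zu = [ flip contradiction ¬uz , id ]′ (isolated-comparable tournament (clean-isolated top-clean) z)

    clean-reaches-bottom : ∀ {z} → Clean z → Reach D z bottom
    clean-reaches-bottom {z} cz with reaches? z bottom
    ... | yes zw = zw
    ... | no ¬zw = contradiction (bottom-minimal cz)
                     (<⇒≱ (below⇒outdeg< (clean-isolated bottom-clean) (clean-isolated cz) (wz , ¬zw)))
      where
      wz : Reach D bottom z
      wz = [ id , flip contradiction ¬zw ]′ (isolated-comparable tournament (clean-isolated bottom-clean) z)

    bottom-reaches-top : Reach D bottom top
    bottom-reaches-top with reaches? bottom top
    ... | yes wu = wu
    ... | no ¬wu = contradiction (≤-trans clean≤ gap≤) (<⇒≱ (<-≤-trans (m<m+n (2 * k) (s≤s z≤n)) count-clean))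
      where
      open ≤-Reasoning
      cu = count (component? top)
      cw = count (component? bottom)
      M? = below? top ∩? ∁? (reaches? bottom)
      m  = count M?

      cover : ∀ {z} → Clean z → (Component top z ⊎ Component bottom z) ⊎ (Below top z × ¬ Reach D bottom z)
      cover {z} cz with reaches? z top | reaches? bottom z
      ... | yes zu | _      = inj₁ (inj₁ (top-reaches-clean cz , zu))
      ... | no _   | yes wz = inj₁ (inj₂ (wz , clean-reaches-bottom cz))
      ... | no ¬zu | no ¬wz = inj₂ ((top-reaches-clean cz , ¬zu) , ¬wz)

      clean≤ : count clean? ≤ cu + cw + m
      clean≤ = begin
        count clean?                                        ≤⟨ count-mono clean? ((component? top ∪? component? bottom) ∪? M?) cover ⟩
        count ((component? top ∪? component? bottom) ∪? M?) ≤⟨ count-∪ (component? top ∪? component? bottom) M? ⟩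
        count (component? top ∪? component? bottom) + m     ≤⟨ +-monoˡ-≤ m (count-∪ (component? top) (component? bottom)) ⟩
        cu + cw + m                                         ∎

      gap≤ : cu + cw + m ≤ 2 * k
      gap≤ = +-cancelˡ-≤ (2 * outdeg T bottom) _ _ (begin
        2 * outdeg T bottom + (cu + cw + m)     ≤⟨ +-monoʳ-≤ (2 * outdeg T bottom) (+-monoʳ-≤ (cu + cw) (m≤m+n m (m + 0))) ⟩
        2 * outdeg T bottom + (cu + cw + 2 * m) ≡⟨ regroup (outdeg T bottom) cu cw m ⟩
        2 * outdeg T bottom + cu + cw + 2 * m   ≡⟨ outdeg-gap (clean-isolated top-clean) (clean-isolated bottom-clean)
                                                               (top-reaches-clean bottom-clean , ¬wu) ⟨
        2 * outdeg T top                        ≤⟨ *-monoʳ-≤ 2 (spread (proj₁ top-clean) (proj₁ bottom-clean)) ⟩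
        2 * (outdeg T bottom + k)               ≡⟨ *-distribˡ-+ 2 (outdeg T bottom) k ⟩
        2 * outdeg T bottom + 2 * k             ∎)
        where
        regroup : ∀ o cu cw m → 2 * o + (cu + cw + 2 * m) ≡ 2 * o + cu + cw + 2 * m
        regroup = solve-∀

    clean⊆component : ∀ {z} → Clean z → Component top z
    clean⊆component cz = top-reaches-clean cz , clean-reaches-bottom cz ◅◅ bottom-reaches-top

    count-component-top : 2 * k + 3 ≤ count (component? top)
    count-component-top = ≤-trans count-clean (count-mono clean? (component? top) clean⊆component)

    Straggler : Pred (Fin n) 0ℓ
    Straggler z = z ∈ X × ¬ Component top z

    straggler? : Decidable Straggler
    straggler? = (_∈? X) ∩? ∁? (component? top)

    straggler-bound : ∀ {y} → Straggler y → (∀ {z} → Straggler z → degree A′ y ≤ degree A′ z) →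
      ∀ e → e ≤ k → e ≤ degree A′ y → count (component? top) + 1 ≤ 2 * k + 2 * e → ⊥
    straggler-bound {y} sy minimal e e≤k e≤degree bound =
      straggler-arithmetic (count (component? top)) (count straggler?) e
        count-component-top bound covered e≤k (0<count straggler? sy) stragglers-light
      where
      open ≤-Reasoning
      covered : 4 * k + 3 ≤ count (component? top) + count straggler?
      covered = begin
        4 * k + 3                                            ≤⟨ large ⟩
        ∣ X ∣                                                ≡⟨ ∣p∣≡count∈ X ⟩
        count (_∈? X)                                        ≡⟨ count-split (_∈? X) (component? top) ⟩
        count ((_∈? X) ∩? component? top) + count straggler? ≤⟨ +-monoˡ-≤ (count straggler?)
                                                                 (count-mono ((_∈? X) ∩? component? top) (component? top) proj₂) ⟩
        count (component? top) + count straggler?            ∎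
      stragglers-light : count straggler? * e ≤ 2 * k
      stragglers-light = begin
        count straggler? * e           ≤⟨ *-monoʳ-≤ (count straggler?) e≤degree ⟩
        count straggler? * degree A′ y ≤⟨ count*c≤∑ straggler? (degree A′) minimal ⟩
        ∑ (degree A′)                  ≡⟨ ∑degree≡2*numArcs A′ ⟩
        2 * numArcs A′                 ≤⟨ *-monoʳ-≤ 2 few-arcs ⟩
        2 * k                          ∎

    minimal-straggler-impossible : ∀ {y} → Straggler y → (∀ {z} → Straggler z → degree A′ y ≤ degree A′ z) → ⊥
    minimal-straggler-impossible {y} sy@(y∈X , ¬cy) minimal
      with component-bound (clean-isolated top-clean) (proj₁ top-clean) y∈X ¬cy
    ... | inj₁ bound = straggler-bound sy minimal (indeg A′ y) (≤-trans (indeg≤numArcs A′ y) few-arcs) (m≤n+m _ _) bound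
    ... | inj₂ bound = straggler-bound sy minimal (outdeg A′ y) (≤-trans (outdeg≤numArcs A′ y) few-arcs) (m≤m+n _ _) bound

    X⊆component : ∀ {z} → z ∈ X → Component top z
    X⊆component {z} z∈X with component? top z
    ... | yes cz = cz
    ... | no ¬cz = let _ , sy , minimal = minimiser straggler? (degree A′) (z , z∈X , ¬cz)
                   in ⊥-elim (minimal-straggler-impossible sy minimal)

lemma2 : (n : ℕ) (T : Digraph n) → IsTournament T →
    (k : ℕ) (A′ : Digraph n) → A′ ⊆Arcs T → IsDESC T A′ → numArcs A′ ≤ k →
    (X : Subset n) → 4 * k + 3 ≤ ∣ X ∣ →
    ((x y : Fin n) → x ∈ X → y ∈ X → outdeg T x ≤ outdeg T y + k) →
    (x y : Fin n) → x ∈ X → y ∈ X → Reach (T − A′) x y × Reach (T − A′) y x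
lemma2 n T tournament k A′ _ desc few-arcs X large spread x y x∈X y∈X =
  proj₂ top-x ◅◅ proj₁ top-y , proj₂ top-y ◅◅ proj₁ top-x
  where
  open Lemma2 tournament desc few-arcs (λ {x} {y} → spread x y)
  top-x = X⊆component large x∈X
  top-y = X⊆component large y∈X
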